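{- Let $\sigma(q) := \sum_{n=0}^{\infty} \frac{q^{n(n+1)/2}}{(-q;q)_n}$ (Ramanujan's $q$-series). Then, as formal power series in $q$ (equivalently for $|q|<1$), $$\sum_{n=0}^{\infty}\sigma_d \mathrm{mex}(n)\,q^n=(-q;q)_{\infty}\,\sigma(q).$$
   Context: For a partition $\pi$ (a multiset of positive integers), $\mathrm{mex}(\pi)$ (the minimal excludant) is the least positive integer that is not a part of $\pi$; in particular the empty partition has $\mathrm{mex}=1$. Let $\mathcal{D}(n)$ be the set of partitions of $n$ into distinct parts (with $\mathcal{D}(0)$ consisting of the empty partition), and $\sigma_d\mathrm{mex}(n) := \sum_{\pi\in\mathcal{D}(n)} \mathrm{mex}(\pi)$. Notation: $(a;q)_0=1$, $(a;q)_n=\prod_{j=0}^{n-1}(1-aq^j)$, $(a;q)_\infty=\prod_{j=0}^{\infty}(1-aq^j)$. -}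

module Defs where

open import Data.Nat as ℕ using (ℕ; zero; suc; _∸_; _≡ᵇ_; _/_)
open import Data.Integer as ℤ using (ℤ; +_; -_)
open import Data.List using (List; []; _∷_; map; foldr; filter; length; upTo; head)
open import Data.List.Membership.DecPropositional (ℕ._≟_) using (_∈?_)
open import Data.Maybe using (fromMaybe)
open import Data.Bool using (if_then_else_)
open import Relation.Nullary.Decidable using (does)

subsets : List ℕ → List (List ℕ)
subsets []       = [] ∷ []
subsets (x ∷ xs) = let r = subsets xs in map (x ∷_) r Data.List.++ r

sumℕ : List ℕ → ℕ
sumℕ = foldr ℕ._+_ 0

oneTo : ℕ → List ℕ
oneTo n = map suc (upTo n)

-- D(n): partitions of n into distinct parts, each given as the list of
-- its (distinct) parts, i.e. the subsets of {1,…,n} with sum n.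
-- D(0) = { empty partition }.
distinctPartitions : ℕ → List (List ℕ)
distinctPartitions n = filter (λ π → sumℕ π ℕ.≟ n) (subsets (oneTo n))

-- mex(π): least positive integer not a part of π (mex of [] is 1).
-- The search over 1,2,…,length π + 1 always succeeds (pigeonhole).
mexGo : List ℕ → ℕ → ℕ → ℕ
mexGo π zero    k = k
mexGo π (suc f) k = if does (k ∈? π) then mexGo π f (suc k) else k

mex : List ℕ → ℕ
mex π = mexGo π (length π) 1

σdmex : ℕ → ℕ
σdmex n = sumℕ (map mex (distinctPartitions n))

FPS : Set
FPS = ℕ → ℤ

sumℤ : List ℤ → ℤ
sumℤ = foldr ℤ._+_ (+ 0)

_⊕_ : FPS → FPS → FPS
(f ⊕ g) n = f n ℤ.+ g n

_⊛_ : FPS → FPS → FPS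
(f ⊛ g) n = sumℤ (map (λ k → f k ℤ.* g (n ∸ k)) (upTo (suc n)))

qpow : ℕ → FPS
qpow k n = if n ≡ᵇ k then + 1 else + 0

oneP : FPS
oneP = qpow 0

-- Multiplicative inverse of a series f with f 0 = 1:
-- coefficients b₀ = 1, b_m = - Σ_{i=1}^{m} f i * b_{m-i}.
-- invList f n = [b_n, b_{n-1}, …, b_0].
invList : FPS → ℕ → List ℤ
invList f zero    = + 1 ∷ []
invList f (suc n) = c ∷ prev
  where
  prev = invList f n
  go : ℕ → List ℤ → ℤ
  go i []       = + 0
  go i (b ∷ bs) = f (suc i) ℤ.* b ℤ.+ go (suc i) bs
  c = - go 0 prev

-- 1 / f  (meaningful when f 0 = 1, which is the case below)
inv : FPS → FPS
inv f n = fromMaybe (+ 0) (head (invList f n))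

negqPoch : ℕ → FPS
negqPoch zero    = oneP
negqPoch (suc n) = negqPoch n ⊛ (oneP ⊕ qpow (suc n))

-- (-q;q)_∞: its q^N coefficient equals that of (-q;q)_N, since the
-- remaining factors (1 + q^j), j > N, do not affect degrees ≤ N.
negqPochInf : FPS
negqPochInf N = negqPoch N N

σterm : ℕ → FPS
σterm n = qpow ((n ℕ.* suc n) / 2) ⊛ inv (negqPoch n)

-- σ(q) = Σ_{n≥0} σterm n.  The term σterm n has order n(n+1)/2 ≥ n,
-- so only n ≤ N contribute to the coefficient of q^N.
σq : FPS
σq N = sumℤ (map (λ n → σterm n N) (upTo (suc N)))

-- Both sides are expanded into the q^N coefficient of
--   Σ_{k ≤ N} q^{1+⋯+k} (−q^{k+1}; q)_{N−k}.
-- Left side: mex π counts the k ≥ 0 with {1,…,k} ⊆ π, and the subsets of {1,…,N} containing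
-- {1,…,k} have generating function q^{1+⋯+k} (−q^{k+1}; q)_{N−k}.
-- Right side: modulo q^{N+1} we may replace (−q; q)_∞ by (−q; q)_N and drop the terms of σ(q)
-- with k > N; then (−q; q)_N / (−q; q)_k = (−q^{k+1}; q)_{N−k} and 1+⋯+k = k(k+1)/2.

module Submission where

open import Defs
open import Algebra.Bundles using (CommutativeMonoid)
import Algebra.Properties.CommutativeSemigroup as CommutativeSemigroupProperties
open import Data.Bool using (true; false)
open import Data.Integer using (ℤ; +_; -_; _+_; _*_)
import Data.Integer.Properties as ℤP
import Data.Integer.Tactic.RingSolver as ℤ-Ring
open import Data.List using (List; []; _∷_; map; filter; _++_; applyUpTo; length)
import Data.List.Properties as LP
open import Data.List.Relation.Unary.All as All using (All; []; _∷_)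
import Data.List.Relation.Unary.All.Properties as AllP
open import Data.Nat as ℕ using (ℕ; zero; suc; _∸_; _≤_; _<_; z≤n; s≤s)
import Data.Nat.Properties as ℕP
open import Data.List.Membership.DecPropositional ℕ._≟_ using (_∈?_)
open import Data.Nat.DivMod using (m*n/n≡m)
open import Data.Nat.ListAction.Properties using (sum-++)
import Data.Nat.Tactic.RingSolver as ℕ-Ring
open import Data.Product using (_,_)
open import Function using (_∘_)
open import Level using (0ℓ)
open import Relation.Binary.Bundles using (Setoid)
open import Relation.Binary.PropositionalEquality
import Relation.Binary.Reasoning.Setoid as SetoidReasoning
open import Relation.Nullary using (Dec; yes; no)
open import Relation.Nullary.Decidable using (does; dec-true; dec-false)

module ℤ+ = CommutativeSemigroupProperties ℤP.+-commutativeSemigroup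

-- Finite sums

∑ : ℕ → (ℕ → ℤ) → ℤ
∑ zero    g = + 0
∑ (suc m) g = g 0 + ∑ m (g ∘ suc)

infix 5 ∑
syntax ∑ m (λ k → e) = ∑[ k < m ] e

∑-cong : ∀ m {g h : ℕ → ℤ} → (∀ k → k < m → g k ≡ h k) → ∑ m g ≡ ∑ m h
∑-cong zero    g≡h = refl
∑-cong (suc m) g≡h = cong₂ _+_ (g≡h 0 (s≤s z≤n)) (∑-cong m (λ k k<m → g≡h (suc k) (s≤s k<m)))

∑-zero : ∀ m {g : ℕ → ℤ} → (∀ k → g k ≡ + 0) → ∑ m g ≡ + 0
∑-zero zero    g≡0 = refl
∑-zero (suc m) g≡0 = cong₂ _+_ (g≡0 0) (∑-zero m (g≡0 ∘ suc))

∑-vanishing-tail : ∀ m d {g : ℕ → ℤ} → (∀ k → m ≤ k → g k ≡ + 0) → ∑ (m ℕ.+ d) g ≡ ∑ m g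
∑-vanishing-tail zero    d g≡0 = ∑-zero d (λ k → g≡0 k z≤n)
∑-vanishing-tail (suc m) d {g} g≡0 = cong (_+_ (g 0)) (∑-vanishing-tail m d (λ k m≤k → g≡0 (suc k) (s≤s m≤k)))

sumℤ-map-applyUpTo : ∀ (g : ℕ → ℤ) (h : ℕ → ℕ) m → sumℤ (map g (applyUpTo h m)) ≡ ∑ m (g ∘ h)
sumℤ-map-applyUpTo g h zero    = refl
sumℤ-map-applyUpTo g h (suc m) = cong (_+_ (g (h 0))) (sumℤ-map-applyUpTo g (h ∘ suc) m)

-- Power series under the Cauchy product

0ₛ : FPS
0ₛ _ = + 0

tail : FPS → FPS
tail f n = f (suc n)

infixl 7 _·_ _⋆_

_·_ : ℤ → FPS → FPS
(c · f) n = c * f n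

_⋆_ : FPS → FPS → FPS
(f ⋆ g) zero    = f 0 * g 0
(f ⋆ g) (suc n) = f 0 * g (suc n) + (tail f ⋆ g) n

⋆-as-∑ : ∀ f g n → (f ⋆ g) n ≡ ∑[ k < suc n ] f k * g (n ∸ k)
⋆-as-∑ f g zero    = sym (ℤP.+-identityʳ _)
⋆-as-∑ f g (suc n) = cong (_+_ (f 0 * g (suc n))) (⋆-as-∑ (tail f) g n)

⊛≗⋆ : ∀ f g → f ⊛ g ≗ f ⋆ g
⊛≗⋆ f g n = trans (sumℤ-map-applyUpTo (λ k → f k * g (n ∸ k)) (λ k → k) (suc n)) (sym (⋆-as-∑ f g n))

⋆-cong : ∀ {f f′ g g′} → f ≗ f′ → g ≗ g′ → f ⋆ g ≗ f′ ⋆ g′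
⋆-cong f≗f′ g≗g′ zero    = cong₂ _*_ (f≗f′ 0) (g≗g′ 0)
⋆-cong f≗f′ g≗g′ (suc n) = cong₂ _+_ (cong₂ _*_ (f≗f′ 0) (g≗g′ (suc n))) (⋆-cong (f≗f′ ∘ suc) g≗g′ n)

⋆-congBelow : ∀ n {f f′ g g′} → (∀ i → i ≤ n → f i ≡ f′ i) → (∀ i → i ≤ n → g i ≡ g′ i) →
              (f ⋆ g) n ≡ (f′ ⋆ g′) n
⋆-congBelow zero    f≡f′ g≡g′ = cong₂ _*_ (f≡f′ 0 z≤n) (g≡g′ 0 z≤n)
⋆-congBelow (suc n) f≡f′ g≡g′ = cong₂ _+_ (cong₂ _*_ (f≡f′ 0 z≤n) (g≡g′ (suc n) ℕP.≤-refl))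
  (⋆-congBelow n (λ i i≤n → f≡f′ (suc i) (s≤s i≤n)) (λ i i≤n → g≡g′ i (ℕP.m≤n⇒m≤1+n i≤n)))

⋆-zeroˡ : ∀ {f} g → f ≗ 0ₛ → f ⋆ g ≗ 0ₛ
⋆-zeroˡ g f≗0 zero    = cong (_* g 0) (f≗0 0)
⋆-zeroˡ g f≗0 (suc n) = cong₂ _+_ (cong (_* g (suc n)) (f≗0 0)) (⋆-zeroˡ g (f≗0 ∘ suc) n)

⋆-distribʳ : ∀ f f′ g → (f ⊕ f′) ⋆ g ≗ (f ⋆ g) ⊕ (f′ ⋆ g)
⋆-distribʳ f f′ g zero    = ℤP.*-distribʳ-+ (g 0) (f 0) (f′ 0)
⋆-distribʳ f f′ g (suc n) = begin
    (f 0 + f′ 0) * g (suc n) + ((tail f ⊕ tail f′) ⋆ g) n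
  ≡⟨ cong₂ _+_ (ℤP.*-distribʳ-+ (g (suc n)) (f 0) (f′ 0)) (⋆-distribʳ (tail f) (tail f′) g n) ⟩
    (f 0 * g (suc n) + f′ 0 * g (suc n)) + ((tail f ⋆ g) n + (tail f′ ⋆ g) n)
  ≡⟨ ℤ+.interchange (f 0 * g (suc n)) _ _ _ ⟩
    (f ⋆ g) (suc n) + (f′ ⋆ g) (suc n)
  ∎
  where open ≡-Reasoning

⋆-scaleˡ : ∀ c f g → (c · f) ⋆ g ≗ c · (f ⋆ g)
⋆-scaleˡ c f g zero    = ℤP.*-assoc c (f 0) (g 0)
⋆-scaleˡ c f g (suc n) = trans (cong₂ _+_ (ℤP.*-assoc c (f 0) (g (suc n))) (⋆-scaleˡ c (tail f) g n))
                               (sym (ℤP.*-distribˡ-+ c _ _))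

⋆-comm : ∀ f g → f ⋆ g ≗ g ⋆ f
⋆-comm f g zero          = ℤP.*-comm (f 0) (g 0)
⋆-comm f g (suc zero)    = trans (ℤP.+-comm (f 0 * g 1) (f 1 * g 0)) (cong₂ _+_ (ℤP.*-comm (f 1) (g 0)) (ℤP.*-comm (f 0) (g 1)))
⋆-comm f g (suc (suc n)) = begin
    f 0 * g (2 ℕ.+ n) + (tail f ⋆ g) (suc n)
  ≡⟨ cong (_+_ (f 0 * g (2 ℕ.+ n))) (⋆-comm (tail f) g (suc n)) ⟩
    f 0 * g (2 ℕ.+ n) + (g 0 * f (2 ℕ.+ n) + (tail g ⋆ tail f) n)
  ≡⟨ cong (λ x → f 0 * g (2 ℕ.+ n) + (g 0 * f (2 ℕ.+ n) + x)) (⋆-comm (tail g) (tail f) n) ⟩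
    f 0 * g (2 ℕ.+ n) + (g 0 * f (2 ℕ.+ n) + (tail f ⋆ tail g) n)
  ≡⟨ ℤ+.x∙yz≈y∙xz (f 0 * g (2 ℕ.+ n)) (g 0 * f (2 ℕ.+ n)) ((tail f ⋆ tail g) n) ⟩
    g 0 * f (2 ℕ.+ n) + (f 0 * g (2 ℕ.+ n) + (tail f ⋆ tail g) n)
  ≡⟨ cong (_+_ (g 0 * f (2 ℕ.+ n))) (⋆-comm (tail g) f (suc n)) ⟨
    (g ⋆ f) (suc (suc n))
  ∎
  where open ≡-Reasoning

⋆-assoc : ∀ f g h → (f ⋆ g) ⋆ h ≗ f ⋆ (g ⋆ h)
⋆-assoc f g h zero    = ℤP.*-assoc (f 0) (g 0) (h 0)
⋆-assoc f g h (suc n) = begin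
    f 0 * g 0 * h (suc n) + (tail (f ⋆ g) ⋆ h) n
  ≡⟨⟩
    f 0 * g 0 * h (suc n) + (((f 0 · tail g) ⊕ (tail f ⋆ g)) ⋆ h) n
  ≡⟨ cong (_+_ (f 0 * g 0 * h (suc n))) (⋆-distribʳ (f 0 · tail g) (tail f ⋆ g) h n) ⟩
    f 0 * g 0 * h (suc n) + (((f 0 · tail g) ⋆ h) n + ((tail f ⋆ g) ⋆ h) n)
  ≡⟨ cong₂ (λ x y → f 0 * g 0 * h (suc n) + (x + y)) (⋆-scaleˡ (f 0) (tail g) h n) (⋆-assoc (tail f) g h n) ⟩
    f 0 * g 0 * h (suc n) + (f 0 * (tail g ⋆ h) n + (tail f ⋆ (g ⋆ h)) n)
  ≡⟨ factor (f 0) (g 0) (h (suc n)) ((tail g ⋆ h) n) ((tail f ⋆ (g ⋆ h)) n) ⟩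
    (f ⋆ (g ⋆ h)) (suc n)
  ∎
  where
  open ≡-Reasoning
  factor : ∀ a b c d e → a * b * c + (a * d + e) ≡ a * (b * c + d) + e
  factor = ℤ-Ring.solve-∀

⋆-identityˡ : ∀ g → oneP ⋆ g ≗ g
⋆-identityˡ g zero    = ℤP.*-identityˡ (g 0)
⋆-identityˡ g (suc n) = trans (cong₂ _+_ (ℤP.*-identityˡ (g (suc n))) (⋆-zeroˡ g (λ _ → refl) n))
                              (ℤP.+-identityʳ (g (suc n)))

⋆-identityʳ : ∀ g → g ⋆ oneP ≗ g
⋆-identityʳ g n = trans (⋆-comm g oneP n) (⋆-identityˡ g n)

⋆-commutativeMonoid : CommutativeMonoid 0ℓ 0ℓ
⋆-commutativeMonoid = record
  { Carrier             = FPS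
  ; _≈_                 = _≗_
  ; _∙_                 = _⋆_
  ; ε                   = oneP
  ; isCommutativeMonoid = record
    { isMonoid = record
      { isSemigroup = record
        { isMagma = record { isEquivalence = Setoid.isEquivalence (ℕ →-setoid ℤ) ; ∙-cong = ⋆-cong }
        ; assoc   = ⋆-assoc
        }
      ; identity = ⋆-identityˡ , ⋆-identityʳ
      }
    ; comm = ⋆-comm
    }
  }

module ⋆CS = CommutativeSemigroupProperties (CommutativeMonoid.commutativeSemigroup ⋆-commutativeMonoid)

⋆-distribˡ : ∀ f g g′ → f ⋆ (g ⊕ g′) ≗ (f ⋆ g) ⊕ (f ⋆ g′)
⋆-distribˡ f g g′ n = trans (⋆-comm f (g ⊕ g′) n)
  (trans (⋆-distribʳ g g′ f n) (cong₂ _+_ (⋆-comm g f n) (⋆-comm g′ f n)))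

⋆-∑ : ∀ f m (G : ℕ → FPS) n → (f ⋆ (λ i → ∑[ k < m ] G k i)) n ≡ ∑[ k < m ] (f ⋆ G k) n
⋆-∑ f zero    G n = trans (⋆-comm f _ n) (⋆-zeroˡ f (λ _ → refl) n)
⋆-∑ f (suc m) G n = trans (⋆-distribˡ f (G 0) (λ i → ∑[ k < m ] G (suc k) i) n)
                          (cong (_+_ ((f ⋆ G 0) n)) (⋆-∑ f m (G ∘ suc) n))

shift : ℕ → FPS → FPS
shift zero    f         = f
shift (suc k) f zero    = + 0
shift (suc k) f (suc n) = shift k f n

shift-cong : ∀ k {f g} → f ≗ g → shift k f ≗ shift k g
shift-cong zero    f≗g         = f≗g
shift-cong (suc k) f≗g zero    = refl
shift-cong (suc k) f≗g (suc n) = shift-cong k f≗g n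

shift-< : ∀ k f n → n < k → shift k f n ≡ + 0
shift-< (suc k) f zero    _         = refl
shift-< (suc k) f (suc n) (s≤s n<k) = shift-< k f n n<k

shift-+ : ∀ k f m → shift k f (k ℕ.+ m) ≡ f m
shift-+ zero    f m = refl
shift-+ (suc k) f m = shift-+ k f m

shift-⊕ : ∀ k f g → shift k (f ⊕ g) ≗ shift k f ⊕ shift k g
shift-⊕ zero    f g n       = refl
shift-⊕ (suc k) f g zero    = refl
shift-⊕ (suc k) f g (suc n) = shift-⊕ k f g n

shift-· : ∀ k c f → shift k (c · f) ≗ c · shift k f
shift-· zero    c f n       = refl
shift-· (suc k) c f zero    = sym (ℤP.*-zeroʳ c)
shift-· (suc k) c f (suc n) = shift-· k c f n

shift-shift : ∀ k l f → shift k (shift l f) ≗ shift (k ℕ.+ l) f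
shift-shift zero    l f n       = refl
shift-shift (suc k) l f zero    = refl
shift-shift (suc k) l f (suc n) = shift-shift k l f n

shift-∑ : ∀ k m (G : ℕ → FPS) n → shift k (λ i → ∑[ j < m ] G j i) n ≡ ∑[ j < m ] shift k (G j) n
shift-∑ zero    m G n       = refl
shift-∑ (suc k) m G zero    = sym (∑-zero m (λ _ → refl))
shift-∑ (suc k) m G (suc n) = shift-∑ k m G n

qpow-⋆ : ∀ k g → qpow k ⋆ g ≗ shift k g
qpow-⋆ zero    g         = ⋆-identityˡ g
qpow-⋆ (suc k) g zero    = refl
qpow-⋆ (suc k) g (suc n) = trans (ℤP.+-identityˡ _) (qpow-⋆ k g n)

qpow≗shift : ∀ k → qpow k ≗ shift k oneP
qpow≗shift k n = trans (sym (⋆-identityʳ (qpow k) n)) (qpow-⋆ k oneP n)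

-- Reciprocals

coeffsDown : FPS → ℕ → List ℤ
coeffsDown f zero    = f 0 ∷ []
coeffsDown f (suc n) = f (suc n) ∷ coeffsDown f n

invList≡coeffsDown : ∀ f n → invList f n ≡ coeffsDown (inv f) n
invList≡coeffsDown f zero    = refl
invList≡coeffsDown f (suc n) = cong (inv f (suc n) ∷_) (invList≡coeffsDown f n)

dotFrom : FPS → ℕ → List ℤ → ℤ
dotFrom f i []       = + 0
dotFrom f i (b ∷ bs) = f (suc i) * b + dotFrom f (suc i) bs

dotFrom-coeffsDown : ∀ f i b n → dotFrom f i (coeffsDown b n) ≡ ((λ k → f (suc (i ℕ.+ k))) ⋆ b) n
dotFrom-coeffsDown f i b zero    = trans (ℤP.+-identityʳ _) (cong (λ j → f (suc j) * b 0) (sym (ℕP.+-identityʳ i)))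
dotFrom-coeffsDown f i b (suc n) = cong₂ _+_
  (cong (λ j → f (suc j) * b (suc n)) (sym (ℕP.+-identityʳ i)))
  (trans (dotFrom-coeffsDown f (suc i) b n) (⋆-cong (λ k → cong (f ∘ suc) (sym (ℕP.+-suc i k))) (λ _ → refl) n))

go≡dotFrom : ∀ f (go : ℕ → List ℤ → ℤ) → (∀ i → go i [] ≡ + 0) →
             (∀ i b bs → go i (b ∷ bs) ≡ f (suc i) * b + go (suc i) bs) →
             ∀ i xs → go i xs ≡ dotFrom f i xs
go≡dotFrom f go go-[] go-∷ i []       = go-[] i
go≡dotFrom f go go-[] go-∷ i (b ∷ bs) =
  trans (go-∷ i b bs) (cong (_+_ (f (suc i) * b)) (go≡dotFrom f go go-[] go-∷ (suc i) bs))

inv-suc : ∀ f n → inv f (suc n) ≡ - (tail f ⋆ inv f) n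
inv-suc f n = begin
    inv f (suc n)                         ≡⟨ recurrence ⟩
    - dotFrom f 0 (invList f n)           ≡⟨ cong (λ xs → - dotFrom f 0 xs) (invList≡coeffsDown f n) ⟩
    - dotFrom f 0 (coeffsDown (inv f) n)  ≡⟨ cong -_ (dotFrom-coeffsDown f 0 (inv f) n) ⟩
    - (tail f ⋆ inv f) n                  ∎
  where
  open ≡-Reasoning
  -- invList's local helper is out of scope; abstracting its arguments 0 and invList f n
  -- lets unification instantiate the function go in go≡dotFrom with it.
  recurrence : inv f (suc n) ≡ - dotFrom f 0 (invList f n)
  recurrence with go≡dotFrom f _ (λ _ → refl) (λ _ _ _ → refl) | 0 | invList f n
  ... | go≡ | i | xs = cong -_ (go≡ i xs)

⋆-inverseʳ : ∀ f → f 0 ≡ + 1 → f ⋆ inv f ≗ oneP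
⋆-inverseʳ f f₀≡1 zero    = cong (_* + 1) f₀≡1
⋆-inverseʳ f f₀≡1 (suc n) = begin
    f 0 * inv f (suc n) + (tail f ⋆ inv f) n
  ≡⟨ cong₂ (λ x y → x * y + (tail f ⋆ inv f) n) f₀≡1 (inv-suc f n) ⟩
    + 1 * - (tail f ⋆ inv f) n + (tail f ⋆ inv f) n
  ≡⟨ cong (_+ (tail f ⋆ inv f) n) (ℤP.*-identityˡ (- (tail f ⋆ inv f) n)) ⟩
    - (tail f ⋆ inv f) n + (tail f ⋆ inv f) n
  ≡⟨ ℤP.+-inverseˡ ((tail f ⋆ inv f) n) ⟩
    + 0
  ∎
  where open ≡-Reasoning

-- Generating functions of subsets

consecutiveSum : ℕ → ℕ → ℕ
consecutiveSum a zero    = 0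
consecutiveSum a (suc k) = a ℕ.+ consecutiveSum (suc a) k

consecutiveSum-snoc : ∀ a k → consecutiveSum a (suc k) ≡ consecutiveSum a k ℕ.+ (a ℕ.+ k)
consecutiveSum-snoc a zero    = refl
consecutiveSum-snoc a (suc k) = trans (cong (a ℕ.+_) (consecutiveSum-snoc (suc a) k)) (rearrange a _ k)
  where
  rearrange : ∀ a s k → a ℕ.+ (s ℕ.+ suc (a ℕ.+ k)) ≡ a ℕ.+ s ℕ.+ (a ℕ.+ suc k)
  rearrange = ℕ-Ring.solve-∀

triangular≡consecutiveSum : ∀ k → k ℕ.* suc k ℕ./ 2 ≡ consecutiveSum 1 k
triangular≡consecutiveSum k = trans (cong (ℕ._/ 2) (sym (double k))) (m*n/n≡m (consecutiveSum 1 k) 2)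
  where
  open ≡-Reasoning
  next : ∀ k → k ℕ.* suc k ℕ.+ suc k ℕ.* 2 ≡ suc k ℕ.* suc (suc k)
  next = ℕ-Ring.solve-∀
  double : ∀ k → consecutiveSum 1 k ℕ.* 2 ≡ k ℕ.* suc k
  double zero    = refl
  double (suc k) = begin
    consecutiveSum 1 (suc k) ℕ.* 2           ≡⟨ cong (ℕ._* 2) (consecutiveSum-snoc 1 k) ⟩
    (consecutiveSum 1 k ℕ.+ suc k) ℕ.* 2     ≡⟨ ℕP.*-distribʳ-+ 2 (consecutiveSum 1 k) (suc k) ⟩
    consecutiveSum 1 k ℕ.* 2 ℕ.+ suc k ℕ.* 2 ≡⟨ cong (ℕ._+ suc k ℕ.* 2) (double k) ⟩
    k ℕ.* suc k ℕ.+ suc k ℕ.* 2              ≡⟨ next k ⟩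
    suc k ℕ.* suc (suc k)                    ∎

≤-consecutiveSum : ∀ a k → k ≤ consecutiveSum (suc a) k
≤-consecutiveSum a zero    = z≤n
≤-consecutiveSum a (suc k) = ℕP.≤-trans (s≤s (≤-consecutiveSum (suc a) k)) (ℕP.+-monoˡ-≤ _ (s≤s z≤n))

range : ℕ → ℕ → List ℕ
range a zero    = []
range a (suc m) = a ∷ range (suc a) m

applyUpTo≡range : ∀ a n {h : ℕ → ℕ} → (∀ k → h k ≡ a ℕ.+ k) → applyUpTo h n ≡ range a n
applyUpTo≡range a zero    h≡ = refl
applyUpTo≡range a (suc n) h≡ = cong₂ _∷_ (trans (h≡ 0) (ℕP.+-identityʳ a))
  (applyUpTo≡range (suc a) n (λ k → trans (h≡ (suc k)) (ℕP.+-suc a k)))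

oneTo≡range : ∀ n → oneTo n ≡ range 1 n
oneTo≡range n = trans (LP.map-upTo suc n) (applyUpTo≡range 1 n (λ _ → refl))

range-All : ∀ a m → All (a ≤_) (range a m)
range-All a zero    = []
range-All a (suc m) = ℕP.≤-refl ∷ All.map ℕP.<⇒≤ (range-All (suc a) m)

subsets-All : ∀ {P : ℕ → Set} xs → All P xs → All (All P) (subsets xs)
subsets-All []       []         = [] ∷ []
subsets-All (x ∷ xs) (px ∷ pxs) = AllP.++⁺ (AllP.map⁺ (All.map (px ∷_) Pxs)) Pxs
  where Pxs = subsets-All xs pxs

sumsTo? : ∀ n (π : List ℕ) → Dec (sumℕ π ≡ n)
sumsTo? n π = sumℕ π ℕ.≟ n

summingTo : ℕ → List (List ℕ) → List (List ℕ)
summingTo n = filter (sumsTo? n)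

summingTo-map-∷ : ∀ x m Ps → summingTo (x ℕ.+ m) (map (x ∷_) Ps) ≡ map (x ∷_) (summingTo m Ps)
summingTo-map-∷ x m []       = refl
summingTo-map-∷ x m (π ∷ Ps) with sumsTo? m π
... | yes Σπ≡m = begin
  summingTo (x ℕ.+ m) (map (x ∷_) (π ∷ Ps))
    ≡⟨ LP.filter-accept (sumsTo? (x ℕ.+ m)) {x ∷ π} {map (x ∷_) Ps} (cong (x ℕ.+_) Σπ≡m) ⟩
  (x ∷ π) ∷ summingTo (x ℕ.+ m) (map (x ∷_) Ps)
    ≡⟨ cong ((x ∷ π) ∷_) (summingTo-map-∷ x m Ps) ⟩
  map (x ∷_) (π ∷ summingTo m Ps)
    ≡⟨ cong (map (x ∷_)) (LP.filter-accept (sumsTo? m) {π} {Ps} Σπ≡m) ⟨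
  map (x ∷_) (summingTo m (π ∷ Ps))
    ∎
  where open ≡-Reasoning
... | no  Σπ≢m = begin
  summingTo (x ℕ.+ m) (map (x ∷_) (π ∷ Ps))
    ≡⟨ LP.filter-reject (sumsTo? (x ℕ.+ m)) {x ∷ π} {map (x ∷_) Ps} (Σπ≢m ∘ ℕP.+-cancelˡ-≡ x _ _) ⟩
  summingTo (x ℕ.+ m) (map (x ∷_) Ps)
    ≡⟨ summingTo-map-∷ x m Ps ⟩
  map (x ∷_) (summingTo m Ps)
    ≡⟨ cong (map (x ∷_)) (LP.filter-reject (sumsTo? m) {π} {Ps} Σπ≢m) ⟨
  map (x ∷_) (summingTo m (π ∷ Ps))
    ∎
  where open ≡-Reasoning

summingTo-map-∷-< : ∀ x n Ps → n < x → summingTo n (map (x ∷_) Ps) ≡ []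
summingTo-map-∷-< x n Ps n<x = LP.filter-none (sumsTo? n) (AllP.map⁺ (All.universal too-big Ps))
  where
  too-big : ∀ π → sumℕ (x ∷ π) ≢ n
  too-big π eq = ℕP.<-irrefl refl (ℕP.<-≤-trans n<x (subst (x ≤_) eq (ℕP.m≤m+n x (sumℕ π))))

weightedGF : (List ℕ → ℕ) → List (List ℕ) → FPS
weightedGF w Ps n = + sumℕ (map w (summingTo n Ps))

countGF : List (List ℕ) → FPS
countGF = weightedGF (λ _ → 1)

weightedGF-++ : ∀ w xs ys → weightedGF w (xs ++ ys) ≗ weightedGF w xs ⊕ weightedGF w ys
weightedGF-++ w xs ys n = begin
  + sumℕ (map w (summingTo n (xs ++ ys)))       ≡⟨ cong (λ Qs → + sumℕ (map w Qs)) (LP.filter-++ (sumsTo? n) xs ys) ⟩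
  + sumℕ (map w (Xs ++ Ys))                     ≡⟨ cong (+_ ∘ sumℕ) (LP.map-++ w Xs Ys) ⟩
  + sumℕ (map w Xs ++ map w Ys)                 ≡⟨ cong +_ (sum-++ (map w Xs) (map w Ys)) ⟩
  + (sumℕ (map w Xs) ℕ.+ sumℕ (map w Ys))       ≡⟨ ℤP.pos-+ (sumℕ (map w Xs)) (sumℕ (map w Ys)) ⟩
  weightedGF w xs n + weightedGF w ys n         ∎
  where
  open ≡-Reasoning
  Xs = summingTo n xs
  Ys = summingTo n ys

weightedGF-map-∷ : ∀ w x Ps → weightedGF w (map (x ∷_) Ps) ≗ shift x (weightedGF (w ∘ (x ∷_)) Ps)
weightedGF-map-∷ w x Ps n with x ℕ.≤? n
... | no  x≰n = trans (cong (λ Qs → + sumℕ (map w Qs)) (summingTo-map-∷-< x n Ps (ℕP.≰⇒> x≰n)))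
                      (sym (shift-< x _ n (ℕP.≰⇒> x≰n)))
... | yes x≤n with ℕP.m≤n⇒∃[o]m+o≡n x≤n
...   | m , refl = begin
  + sumℕ (map w (summingTo (x ℕ.+ m) (map (x ∷_) Ps))) ≡⟨ cong (λ Qs → + sumℕ (map w Qs)) (summingTo-map-∷ x m Ps) ⟩
  + sumℕ (map w (map (x ∷_) (summingTo m Ps)))         ≡⟨ cong (+_ ∘ sumℕ) (LP.map-∘ (summingTo m Ps)) ⟨
  weightedGF (w ∘ (x ∷_)) Ps m                         ≡⟨ shift-+ x _ m ⟨
  shift x (weightedGF (w ∘ (x ∷_)) Ps) (x ℕ.+ m)       ∎
  where open ≡-Reasoning

weightedGF-cong : ∀ {w w′} Ps → w ≗ w′ → weightedGF w Ps ≗ weightedGF w′ Ps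
weightedGF-cong Ps w≗w′ n = cong (+_ ∘ sumℕ) (LP.map-cong w≗w′ (summingTo n Ps))

sumℕ-map-const : ∀ {w : List ℕ → ℕ} {c} Ps → All (λ π → w π ≡ c) Ps →
                 sumℕ (map w Ps) ≡ c ℕ.* sumℕ (map (λ _ → 1) Ps)
sumℕ-map-const {c = c} []       []           = sym (ℕP.*-zeroʳ c)
sumℕ-map-const {c = c} (π ∷ Ps) (wπ≡c ∷ w≡c) =
  trans (cong₂ ℕ._+_ wπ≡c (sumℕ-map-const Ps w≡c)) (sym (ℕP.*-suc c (sumℕ (map (λ _ → 1) Ps))))

weightedGF-const : ∀ {w : List ℕ → ℕ} {c} Ps → All (λ π → w π ≡ c) Ps → weightedGF w Ps ≗ + c · countGF Ps
weightedGF-const {c = c} Ps w≡c n = trans (cong +_ (sumℕ-map-const (summingTo n Ps) (AllP.filter⁺ (sumsTo? n) w≡c)))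
                                          (ℤP.pos-* c (sumℕ (map (λ _ → 1) (summingTo n Ps))))

mexFrom : ℕ → List ℕ → ℕ
mexFrom a π = mexGo π (length π) a

mexGo-∷-< : ∀ fuel a k π → a < k → mexGo (a ∷ π) fuel k ≡ mexGo π fuel k
mexGo-∷-< zero       a k π a<k = refl
mexGo-∷-< (suc fuel) a k π a<k rewrite dec-false (k ℕ.≟ a) (ℕP.>⇒≢ a<k) with does (k ∈? π)
... | true  = mexGo-∷-< fuel a (suc k) π (ℕP.m≤n⇒m≤1+n a<k)
... | false = refl

mexFrom-∷ : ∀ a π → mexFrom a (a ∷ π) ≡ mexFrom (suc a) π
mexFrom-∷ a π rewrite dec-true (a ℕ.≟ a) refl = mexGo-∷-< (length π) a (suc a) π ℕP.≤-refl

mexFrom-fresh : ∀ a π → All (a <_) π → mexFrom a π ≡ a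
mexFrom-fresh a []      _       = refl
mexFrom-fresh a (b ∷ π) a<π rewrite dec-false (a ∈? (b ∷ π)) (λ a∈π → ℕP.<-irrefl refl (All.lookup a<π a∈π)) = refl

-- (−q^a; q)_m = (1 + q^a) ⋯ (1 + q^{a+m−1}), the generating function of subsets of {a, …, a+m−1}
negPochFrom : ℕ → ℕ → FPS
negPochFrom a zero    = oneP
negPochFrom a (suc m) = shift a (negPochFrom (suc a) m) ⊕ negPochFrom (suc a) m

-- Generating function of mexFrom a π − a over the subsets π of {a, …, a+m−1}
runGF : ℕ → ℕ → FPS
runGF a zero    = 0ₛ
runGF a (suc m) = shift a (negPochFrom (suc a) m ⊕ runGF (suc a) m)

countGF-subsets : ∀ a m → countGF (subsets (range a m)) ≗ negPochFrom a m
countGF-subsets a zero    zero    = refl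
countGF-subsets a zero    (suc n) = refl
countGF-subsets a (suc m) n = begin
  countGF (map (a ∷_) Ss ++ Ss) n            ≡⟨ weightedGF-++ (λ _ → 1) (map (a ∷_) Ss) Ss n ⟩
  countGF (map (a ∷_) Ss) n + countGF Ss n   ≡⟨ cong (_+ countGF Ss n) (weightedGF-map-∷ (λ _ → 1) a Ss n) ⟩
  shift a (countGF Ss) n + countGF Ss n      ≡⟨ cong₂ _+_ (shift-cong a (countGF-subsets (suc a) m) n)
                                                          (countGF-subsets (suc a) m n) ⟩
  negPochFrom a (suc m) n                    ∎
  where
  open ≡-Reasoning
  Ss = subsets (range (suc a) m)

mexGF-subsets : ∀ a m → weightedGF (mexFrom a) (subsets (range a m)) ≗ (+ a · negPochFrom a m) ⊕ runGF a m
mexGF-subsets a zero    zero    = trans (cong +_ (ℕP.+-identityʳ a))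
                                        (sym (trans (ℤP.+-identityʳ _) (ℤP.*-identityʳ (+ a))))
mexGF-subsets a zero    (suc n) = sym (cong (_+ + 0) (ℤP.*-zeroʳ (+ a)))
mexGF-subsets a (suc m) n = begin
  weightedGF (mexFrom a) (map (a ∷_) Ss ++ Ss) n
    ≡⟨ weightedGF-++ (mexFrom a) (map (a ∷_) Ss) Ss n ⟩
  weightedGF (mexFrom a) (map (a ∷_) Ss) n + weightedGF (mexFrom a) Ss n
    ≡⟨ cong₂ _+_ (weightedGF-map-∷ (mexFrom a) a Ss n)
                 (weightedGF-const Ss (All.map (mexFrom-fresh a _) above-a) n) ⟩
  shift a (weightedGF (mexFrom a ∘ (a ∷_)) Ss) n + + a * countGF Ss n
    ≡⟨ cong₂ _+_ (shift-cong a (weightedGF-cong Ss (mexFrom-∷ a)) n)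
                 (cong (+ a *_) (countGF-subsets (suc a) m n)) ⟩
  shift a (weightedGF (mexFrom (suc a)) Ss) n + + a * E n
    ≡⟨ cong (_+ + a * E n) (shift-cong a (mexGF-subsets (suc a) m) n) ⟩
  shift a ((+ suc a · E) ⊕ R) n + + a * E n
    ≡⟨ cong (_+ + a * E n) (trans (shift-⊕ a (+ suc a · E) R n) (cong (_+ shift a R n) (shift-· a (+ suc a) E n))) ⟩
  (+ suc a * shift a E n + shift a R n) + + a * E n
    ≡⟨ regroup (+ a) (shift a E n) (shift a R n) (E n) ⟩
  + a * (shift a E n + E n) + (shift a E n + shift a R n)
    ≡⟨ cong (_+_ (+ a * (shift a E n + E n))) (shift-⊕ a E R n) ⟨
  ((+ a · negPochFrom a (suc m)) ⊕ runGF a (suc m)) n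
    ∎
  where
  open ≡-Reasoning
  Ss = subsets (range (suc a) m)
  E  = negPochFrom (suc a) m
  R  = runGF (suc a) m
  above-a : All (All (a <_)) Ss
  above-a = subsets-All (range (suc a) m) (range-All (suc a) m)
  regroup : ∀ a s r e → ((+ 1 + a) * s + r) + a * e ≡ a * (s + e) + (s + r)
  regroup = ℤ-Ring.solve-∀

runGF-as-∑ : ∀ a m n →
  runGF a m n ≡ ∑[ j < m ] shift (consecutiveSum a (suc j)) (negPochFrom (a ℕ.+ suc j) (m ∸ suc j)) n
runGF-as-∑ a zero    n = refl
runGF-as-∑ a (suc m) n = begin
  shift a (E ⊕ runGF (suc a) m) n
    ≡⟨ shift-⊕ a E (runGF (suc a) m) n ⟩
  shift a E n + shift a (runGF (suc a) m) n
    ≡⟨ cong₂ _+_ first (trans (shift-cong a (runGF-as-∑ (suc a) m) n) (shift-∑ a m _ n)) ⟩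
  term 0 + (∑[ j < m ] shift a (shift (consecutiveSum (suc a) (suc j)) (negPochFrom (suc a ℕ.+ suc j) (m ∸ suc j))) n)
    ≡⟨ cong (_+_ (term 0)) (∑-cong m (λ j _ → later j)) ⟩
  (∑[ j < suc m ] term j)
    ∎
  where
  open ≡-Reasoning
  E = negPochFrom (suc a) m
  term : ℕ → ℤ
  term j = shift (consecutiveSum a (suc j)) (negPochFrom (a ℕ.+ suc j) (suc m ∸ suc j)) n
  first : shift a E n ≡ term 0
  first = cong₂ (λ k b → shift k (negPochFrom b m) n) (sym (ℕP.+-identityʳ a)) (ℕP.+-comm 1 a)
  later : ∀ j → shift a (shift (consecutiveSum (suc a) (suc j)) (negPochFrom (suc a ℕ.+ suc j) (m ∸ suc j))) n
              ≡ term (suc j)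
  later j = trans (shift-shift a _ _ n)
                  (cong (λ b → shift (consecutiveSum a (2 ℕ.+ j)) (negPochFrom b (m ∸ suc j)) n) (sym (ℕP.+-suc a (suc j))))

initialSegmentSum : ℕ → ℤ
initialSegmentSum N = ∑[ k < suc N ] shift (consecutiveSum 1 k) (negPochFrom (suc k) (N ∸ k)) N

σdmex≡initialSegmentSum : ∀ N → + σdmex N ≡ initialSegmentSum N
σdmex≡initialSegmentSum N = begin
  weightedGF (mexFrom 1) (subsets (oneTo N)) N
    ≡⟨ cong (λ xs → weightedGF (mexFrom 1) (subsets xs) N) (oneTo≡range N) ⟩
  weightedGF (mexFrom 1) (subsets (range 1 N)) N
    ≡⟨ mexGF-subsets 1 N N ⟩
  + 1 * negPochFrom 1 N N + runGF 1 N N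
    ≡⟨ cong₂ _+_ (ℤP.*-identityˡ (negPochFrom 1 N N)) (runGF-as-∑ 1 N N) ⟩
  initialSegmentSum N
    ∎
  where open ≡-Reasoning

-- The product side

negPochFrom-suc : ∀ a m → negPochFrom a (suc m) ≗ (oneP ⊕ qpow a) ⋆ negPochFrom (suc a) m
negPochFrom-suc a m n = sym (begin
  ((oneP ⊕ qpow a) ⋆ E) n        ≡⟨ ⋆-distribʳ oneP (qpow a) E n ⟩
  (oneP ⋆ E) n + (qpow a ⋆ E) n  ≡⟨ cong₂ _+_ (⋆-identityˡ E n) (qpow-⋆ a E n) ⟩
  E n + shift a E n              ≡⟨ ℤP.+-comm (E n) (shift a E n) ⟩
  negPochFrom a (suc m) n        ∎)
  where open ≡-Reasoning
        E = negPochFrom (suc a) m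

negPochFrom-+ : ∀ a k m → negPochFrom a (k ℕ.+ m) ≗ negPochFrom a k ⋆ negPochFrom (a ℕ.+ k) m
negPochFrom-+ a zero    m n = trans (cong (λ b → negPochFrom b m n) (sym (ℕP.+-identityʳ a))) (sym (⋆-identityˡ _ n))
negPochFrom-+ a (suc k) m n = begin
  negPochFrom a (suc (k ℕ.+ m)) n
    ≡⟨ negPochFrom-suc a (k ℕ.+ m) n ⟩
  ((oneP ⊕ qpow a) ⋆ negPochFrom (suc a) (k ℕ.+ m)) n
    ≡⟨ ⋆-cong (λ _ → refl) (negPochFrom-+ (suc a) k m) n ⟩
  ((oneP ⊕ qpow a) ⋆ (negPochFrom (suc a) k ⋆ negPochFrom (suc a ℕ.+ k) m)) n
    ≡⟨ ⋆-assoc (oneP ⊕ qpow a) _ _ n ⟨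
  (((oneP ⊕ qpow a) ⋆ negPochFrom (suc a) k) ⋆ negPochFrom (suc a ℕ.+ k) m) n
    ≡⟨ ⋆-cong (λ i → sym (negPochFrom-suc a k i)) (λ i → cong (λ b → negPochFrom b m i) (sym (ℕP.+-suc a k))) n ⟩
  (negPochFrom a (suc k) ⋆ negPochFrom (a ℕ.+ suc k) m) n
    ∎
  where open ≡-Reasoning

negqPoch≗negPochFrom : ∀ k → negqPoch k ≗ negPochFrom 1 k
negqPoch≗negPochFrom zero    n = refl
negqPoch≗negPochFrom (suc k) n = begin
  (negqPoch k ⊛ (oneP ⊕ qpow (suc k))) n
    ≡⟨ ⊛≗⋆ (negqPoch k) _ n ⟩
  (negqPoch k ⋆ (oneP ⊕ qpow (suc k))) n
    ≡⟨ ⋆-cong (negqPoch≗negPochFrom k) (λ i → trans (cong (_+_ (oneP i)) (qpow≗shift (suc k) i)) (ℤP.+-comm (oneP i) _)) n ⟩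
  (negPochFrom 1 k ⋆ negPochFrom (suc k) 1) n
    ≡⟨ negPochFrom-+ 1 k 1 n ⟨
  negPochFrom 1 (k ℕ.+ 1) n
    ≡⟨ cong (λ j → negPochFrom 1 j n) (ℕP.+-comm k 1) ⟩
  negPochFrom 1 (suc k) n
    ∎
  where open ≡-Reasoning

negPochFrom-< : ∀ a m i → i < a → negPochFrom a m i ≡ oneP i
negPochFrom-< a zero    i _   = refl
negPochFrom-< a (suc m) i i<a = trans (cong₂ _+_ (shift-< a _ i i<a) (negPochFrom-< (suc a) m i (ℕP.m≤n⇒m≤1+n i<a)))
                                      (ℤP.+-identityˡ _)

negqPoch-0 : ∀ k → negqPoch k 0 ≡ + 1
negqPoch-0 k = trans (negqPoch≗negPochFrom k 0) (negPochFrom-< 1 k 0 (s≤s z≤n))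

negqPoch-stable : ∀ {N i} → i ≤ N → negqPoch N i ≡ negqPochInf i
negqPoch-stable {N} {i} i≤N = begin
  negqPoch N i                                       ≡⟨ negqPoch≗negPochFrom N i ⟩
  negPochFrom 1 N i                                  ≡⟨ cong (λ j → negPochFrom 1 j i) (ℕP.m+[n∸m]≡n i≤N) ⟨
  negPochFrom 1 (i ℕ.+ (N ∸ i)) i                    ≡⟨ negPochFrom-+ 1 i (N ∸ i) i ⟩
  (negPochFrom 1 i ⋆ negPochFrom (suc i) (N ∸ i)) i  ≡⟨ ⋆-congBelow i (λ _ _ → refl) (λ j j≤i → negPochFrom-< (suc i) (N ∸ i) j (s≤s j≤i)) ⟩
  (negPochFrom 1 i ⋆ oneP) i                         ≡⟨ ⋆-identityʳ (negPochFrom 1 i) i ⟩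
  negPochFrom 1 i i                                  ≡⟨ negqPoch≗negPochFrom i i ⟨
  negqPochInf i                                      ∎
  where open ≡-Reasoning

σterm≗shift : ∀ k → σterm k ≗ shift (consecutiveSum 1 k) (inv (negqPoch k))
σterm≗shift k n = begin
  (qpow (T k) ⊛ inv (negqPoch k)) n              ≡⟨ ⊛≗⋆ (qpow (T k)) (inv (negqPoch k)) n ⟩
  (qpow (T k) ⋆ inv (negqPoch k)) n              ≡⟨ qpow-⋆ (T k) (inv (negqPoch k)) n ⟩
  shift (T k) (inv (negqPoch k)) n               ≡⟨ cong (λ t → shift t (inv (negqPoch k)) n) (triangular≡consecutiveSum k) ⟩
  shift (consecutiveSum 1 k) (inv (negqPoch k)) n ∎
  where
  open ≡-Reasoning
  T : ℕ → ℕ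
  T k = k ℕ.* suc k ℕ./ 2

σterm-< : ∀ k i → i < k → σterm k i ≡ + 0
σterm-< k i i<k = trans (σterm≗shift k i) (shift-< (consecutiveSum 1 k) _ i (ℕP.<-≤-trans i<k (≤-consecutiveSum 0 k)))

negqPoch⋆σterm : ∀ {N k} → k ≤ N → negqPoch N ⋆ σterm k ≗ shift (consecutiveSum 1 k) (negPochFrom (suc k) (N ∸ k))
negqPoch⋆σterm {N} {k} k≤N = begin
  negqPoch N ⋆ σterm k    ≈⟨ ⋆-cong split (σterm≗shift k) ⟩
  (P ⋆ R) ⋆ shift T I     ≈⟨ ⋆-cong (λ _ → refl) (λ i → trans (sym (qpow-⋆ T I i)) (⋆-comm (qpow T) I i)) ⟩
  (P ⋆ R) ⋆ (I ⋆ qpow T)  ≈⟨ ⋆CS.interchange P R I (qpow T) ⟩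
  (P ⋆ I) ⋆ (R ⋆ qpow T)  ≈⟨ ⋆-cong P⋆I≗1 (⋆-comm R (qpow T)) ⟩
  oneP ⋆ (qpow T ⋆ R)     ≈⟨ ⋆-identityˡ (qpow T ⋆ R) ⟩
  qpow T ⋆ R              ≈⟨ qpow-⋆ T R ⟩
  shift T R               ∎
  where
  open SetoidReasoning (CommutativeMonoid.setoid ⋆-commutativeMonoid)
  T = consecutiveSum 1 k
  P = negPochFrom 1 k
  R = negPochFrom (suc k) (N ∸ k)
  I = inv (negqPoch k)
  split : negqPoch N ≗ P ⋆ R
  split i = trans (negqPoch≗negPochFrom N i)
                  (trans (cong (λ j → negPochFrom 1 j i) (sym (ℕP.m+[n∸m]≡n k≤N))) (negPochFrom-+ 1 k (N ∸ k) i))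
  P⋆I≗1 : P ⋆ I ≗ oneP
  P⋆I≗1 i = trans (⋆-cong (λ j → sym (negqPoch≗negPochFrom k j)) (λ _ → refl) i) (⋆-inverseʳ (negqPoch k) (negqPoch-0 k) i)

σq-as-∑ : ∀ {N i} → i ≤ N → σq i ≡ ∑[ k < suc N ] σterm k i
σq-as-∑ {N} {i} i≤N = begin
  σq i                                  ≡⟨ sumℤ-map-applyUpTo (λ k → σterm k i) (λ k → k) (suc i) ⟩
  ∑[ k < suc i ] σterm k i               ≡⟨ ∑-vanishing-tail (suc i) (N ∸ i) (λ k i<k → σterm-< k i i<k) ⟨
  ∑[ k < suc i ℕ.+ (N ∸ i) ] σterm k i   ≡⟨ cong (λ m → ∑[ k < suc m ] σterm k i) (ℕP.m+[n∸m]≡n i≤N) ⟩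
  ∑[ k < suc N ] σterm k i               ∎
  where open ≡-Reasoning

negqPochInf⊛σq≡initialSegmentSum : ∀ N → (negqPochInf ⊛ σq) N ≡ initialSegmentSum N
negqPochInf⊛σq≡initialSegmentSum N = begin
  (negqPochInf ⊛ σq) N                               ≡⟨ ⊛≗⋆ negqPochInf σq N ⟩
  (negqPochInf ⋆ σq) N                               ≡⟨ ⋆-congBelow N (λ _ i≤N → sym (negqPoch-stable i≤N)) (λ _ → σq-as-∑) ⟩
  (negqPoch N ⋆ (λ i → ∑[ k < suc N ] σterm k i)) N  ≡⟨ ⋆-∑ (negqPoch N) (suc N) σterm N ⟩
  (∑[ k < suc N ] (negqPoch N ⋆ σterm k) N)          ≡⟨ ∑-cong (suc N) (λ k k<1+N → negqPoch⋆σterm (ℕP.≤-pred k<1+N) N) ⟩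
  initialSegmentSum N                                ∎
  where open ≡-Reasoning

theorem2p1 : (n : ℕ) → + (σdmex n) ≡ (negqPochInf ⊛ σq) n
theorem2p1 n = trans (σdmex≡initialSegmentSum n) (sym (negqPochInf⊛σq≡initialSegmentSum n))
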